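{- For every $i\in\mathbb{N}_0$ there is a quadtree configuration $T$ with $\mathrm{cap}(T)\ge 4^{ -i}$, whose smallest assigned square is an $s$-square, such that every insertion of an $i$-square into $T$ has movement cost at least \[ 4^{\min\{s-i,\, i\}}-1. \] Moreover, this lower bound is in $\Omega(2^{h(T)})$: there is an absolute constant $c>0$ such that for every $i\ge 1$ the configuration $T$ can be chosen so that this lower bound is at least $c\cdot 2^{h(T)}$.
   Context: The unit square $[0,1]^2$ is recursively subdivided as a quadtree of unbounded depth: the root (layer $0$) is $[0,1]^2$, and every node (pixel) of layer $j$ is an axis-parallel square of side $2^{ -j}$ whose four children are its four quadrants. A pixel of layer $j$ is a $j$-pixel. For $r\in\mathbb{N}_0$, an $r$-square is an axis-parallel square of side $2^{ -r}$. A (quadtree) configuration $T$ assigns finitely many squares to pixels, each $j$-square to a $j$-pixel, at most one square per pixel, such that no pixel with an assigned square is a proper descendant of another pixel with an assigned square. A pixel $p$ contains a square if it is assigned to $p$ or to a descendant of $p$. A pixel with an assigned square is occupied. A non-occupied pixel is blocked if some ancestor is occupied, free otherwise; a free pixel is empty if it contains no square. The capacity $\mathrm{cap}(p)$ of a $j$-pixel $p$ is $0$ if $p$ is occupied or blocked, $4^{ -j}$ if $p$ is empty, and otherwise the sum of the capacities of its four children; $\mathrm{cap}(T)$ is the capacity of the root. The height $h(T)$ is $0$ if the root is empty and otherwise the maximum of $r+1$ over all $r$ such that $T$ contains an $r$-square. A move takes a $j$-square assigned to a $j$-pixel $p$ and reassigns it to a $j$-pixel $q$ that is empty before the move; moves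 are performed one at a time. Inserting an $i$-square $Q$ into $T$ means performing a sequence of moves producing a configuration with an empty $i$-pixel and then assigning $Q$ to it. If $\{s_1,\dots,s_k\}$ is the set of squares moved during the insertion, its movement cost is $k$. -}

module Defs where

open import Data.Nat as ℕ using (ℕ; zero; suc; _∸_; _^_; _⊔_)
open import Data.Nat.Properties using (m^n≢0)
open import Data.Fin using (Fin; _≟_)
open import Data.List using (List; []; _∷_; _∷ʳ_; length; map; foldr; deduplicate)
open import Data.Bool.ListAction using (any)
open import Data.List as L using (allFin)
open import Data.Bool using (Bool; true; false; _∧_; _∨_; not; if_then_else_; T)
open import Data.Integer using (+_)
open import Data.Rational as ℚ using (ℚ; 0ℚ; _/_)
open import Data.Product using (_×_; ∃-syntax)
open import Data.Sum using (_⊎_)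
open import Relation.Nullary using (¬_; ⌊_⌋)
open import Relation.Binary.PropositionalEquality using (_≡_; _≢_)

-- Pixels: a j-pixel is the path (root first) of j quadrant choices.

Quad : Set
Quad = Fin 4

Pixel : Set
Pixel = List Quad

-- layer of a pixel (its side is 2^-layer)
layer : Pixel → ℕ
layer = length

_⊑ᵇ_ : Pixel → Pixel → Bool
[] ⊑ᵇ q = true
(a ∷ p) ⊑ᵇ [] = false
(a ∷ p) ⊑ᵇ (b ∷ q) = ⌊ a ≟ b ⌋ ∧ (p ⊑ᵇ q)

_⊑_ : Pixel → Pixel → Set
p ⊑ q = T (p ⊑ᵇ q)

_=ᵇ_ : Pixel → Pixel → Bool
p =ᵇ q = (p ⊑ᵇ q) ∧ (q ⊑ᵇ p)

children : Pixel → List Pixel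
children p = L.map (p ∷ʳ_) (allFin 4)

-- Configurations. Squares are identified by k : Fin n; pos k is the pixel
-- to which square k is assigned (a j-square sits at a j-pixel, so the size
-- of square k is determined by layer (pos k)).

Placement : ℕ → Set
Placement n = Fin n → Pixel

Valid : ∀ {n} → Placement n → Set
Valid {n} P = ∀ (a b : Fin n) → a ≢ b → ¬ (P a ⊑ P b)

record Config : Set where
  field
    n     : ℕ
    pos   : Placement n
    valid : Valid pos
open Config public

-- q is empty: free (neither occupied nor below an occupied pixel) and
-- contains no square (no square assigned to q or a descendant of q).
Empty : ∀ {n} → Placement n → Pixel → Set
Empty P q = ∀ k → ¬ (P k ⊑ q) × ¬ (q ⊑ P k)

anyᵇ : ∀ {n} → Placement n → (Pixel → Bool) → Bool
anyᵇ {n} P f = any (λ k → f (P k)) (allFin n)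

occOrBlockedᵇ : ∀ {n} → Placement n → Pixel → Bool
occOrBlockedᵇ P p = anyᵇ P (λ x → x ⊑ᵇ p)

containsᵇ : ∀ {n} → Placement n → Pixel → Bool
containsᵇ P p = anyᵇ P (λ x → p ⊑ᵇ x)

inv4^ : ℕ → ℚ
inv4^ j = (+ 1 / (4 ^ j)) {{m^n≢0 4 j}}

sumℚ : List ℚ → ℚ
sumℚ = foldr ℚ._+_ 0ℚ

-- capacity of pixel p, with a depth budget (fuel) for the recursion
capAt : ∀ {n} → ℕ → Placement n → Pixel → ℚ
capAt fuel P p =
  if occOrBlockedᵇ P p then 0ℚ
  else if not (containsᵇ P p) then inv4^ (layer p)
  else go fuel
  where
  go : ℕ → ℚ
  go zero = 0ℚ
  go (suc f) = sumℚ (L.map (capAt f P) (children p))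

maxLayer : ∀ {n} → Placement n → ℕ
maxLayer {n} P = foldr _⊔_ 0 (L.map (λ k → layer (P k)) (allFin n))

-- cap(T): the fuel maxLayer suffices, since the recursive branch at a
-- pixel p is only taken when p contains a square of layer > layer p.
cap : Config → ℚ
cap C = capAt (suc (maxLayer (pos C))) (pos C) []

height : Config → ℕ
height C with n C
... | zero = 0
... | suc _ = suc (maxLayer (pos C))

-- the smallest assigned square is an s-square
-- (for the configuration without squares, every s qualifies)
SmallestIs : Config → ℕ → Set
SmallestIs C s = (∀ k → layer (pos C k) ℕ.≤ s) × (n C ≡ 0 ⊎ ∃[ k ] layer (pos C k) ≡ s)

Move : ∀ {n} → Placement n → Placement n → Fin n → Set
Move P P' k = Empty P (P' k) × layer (P' k) ≡ layer (P k) × (∀ k' → k' ≢ k → P' k' ≡ P k')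

data Moves {n : ℕ} : Placement n → Placement n → List (Fin n) → Set where
  done : ∀ {P} → Moves P P []
  step : ∀ {P P' P'' k ks} → Move P P' k → Moves P' P'' ks → Moves P P'' (k ∷ ks)

cost : ∀ {n} → List (Fin n) → ℕ
cost ks = length (deduplicate _≟_ ks)

InsertionCostAtLeast : Config → ℕ → ℕ → Set
InsertionCostAtLeast C i b =
  ∀ (P' : Placement (n C)) (ks : List (Fin (n C))) →
  Moves (pos C) P' ks →
  (∃[ q ] (layer q ≡ i × Empty P' q)) →
  b ℕ.≤ cost ks

bound : ℕ → ℕ → ℕ
bound i s = 4 ^ ℕ._⊓_ (s ∸ i) i ∸ 1

Good : ℕ → Config → ℕ → Set
Good i C s = inv4^ i ℚ.≤ cap C × SmallestIs C s × InsertionCostAtLeast C i (bound i s)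

module Submission where

-- For every i, let T_i be the configuration that, inside every i-pixel q,
-- assigns a 2i-square to every 2i-pixel below q except the corner q ++ 0^i.
--  * Capacity: the 4^i corners are empty, each of area 4^-2i, so
--    cap(T_i) ≥ 4^-i.  This follows from a general lower bound: if every
--    h-descendant of p has an empty d-corner, then cap(p) ≥ 4^-(layer p + d).
--  * Cost: an i-pixel q becomes empty only after every square initially below
--    q has been moved, and there are 4^i - 1 of them below each i-pixel.
--  * Size: all squares are 2i-squares, so s = 2i, min(s-i,i) = i,
--    h(T_i) ≤ 2i+1, and 2^(2i+1) ≤ 8·(4^i - 1) for i ≥ 1, whence c = 1/8.
-- The file proves counting facts on lists, enumerates the pixels of a layer
-- (with and without corners), develops the prefix order, computes with the
-- areas 4^-j, proves the capacity and cost lower bounds for arbitrary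
-- placements, then builds T_i (module Construction) and derives theorem5.

open import Defs
open import Data.Nat as ℕ
  using (ℕ; zero; suc; _+_; _^_; _∸_; _≤_; z≤n; s≤s; _⊔_; NonZero)
import Data.Nat.Properties as ℕP
open import Data.Integer.Tactic.RingSolver using (solve-∀)
open import Data.Fin using (Fin; zero; suc) renaming (_≟_ to _≟F_)
import Data.Fin.Properties as FinP
open import Data.List as L
  using (List; []; _∷_; _++_; _∷ʳ_; length; lookup; replicate; allFin; foldr; cartesianProductWith; deduplicate)
import Data.List.Properties as LP
open import Data.List.Membership.Propositional using (_∈_)
open import Data.List.Membership.Propositional.Properties
  using (∈-lookup; ∈-allFin; ∈-map⁺; ∈-map⁻; ∈-++⁺ˡ; ∈-++⁺ʳ; ∈-++⁻;
         ∈-cartesianProductWith⁺; ∈-cartesianProductWith⁻; ∈-deduplicate⁺)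
import Data.List.Relation.Unary.Any as Any
open import Data.List.Relation.Unary.Any using (here; there)
open import Data.List.Relation.Unary.Any.Properties using (lookup-index; any⁻)
import Data.List.Relation.Unary.All as All
open import Data.List.Relation.Unary.AllPairs using ([]; _∷_)
open import Data.List.Relation.Unary.Unique.Propositional using (Unique)
import Data.List.Relation.Unary.Unique.Propositional.Properties as Unique
open import Data.List.Relation.Binary.Disjoint.Propositional using (Disjoint)
open import Data.Bool using (Bool; true; false; T)
open import Data.Unit using (tt)
open import Data.Empty using (⊥-elim)
open import Data.Integer using (+_)
open import Data.Integer.Properties using (pos-*)
import Data.Integer as ℤ
open import Data.Rational using (ℚ; 0ℚ; _<_; _*_; _/_; toℚᵘ)
open import Data.Rational using () renaming (_≤_ to _≤ℚ_; _+_ to _+ℚ_)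
import Data.Rational.Properties as ℚP
open import Data.Rational.Unnormalised as ℚᵘ using (mkℚᵘ; *≤*; *≡*)
import Data.Rational.Unnormalised.Properties as ℚᵘP
open import Data.Product using (_×_; _,_; proj₁; proj₂; ∃-syntax; ∃₂)
open import Data.Sum using (_⊎_; inj₁; inj₂)
open import Relation.Nullary using (¬_; yes; no)
open import Relation.Binary.PropositionalEquality

length-cartesianProductWith : ∀ {A B C : Set} (f : A → B → C) (xs : List A) (ys : List B) →
                              length (cartesianProductWith f xs ys) ≡ length xs ℕ.* length ys
length-cartesianProductWith f [] ys = refl
length-cartesianProductWith f (x ∷ xs) ys = begin
  length (L.map (f x) ys ++ cartesianProductWith f xs ys)        ≡⟨ LP.length-++ (L.map (f x) ys) ⟩
  length (L.map (f x) ys) + length (cartesianProductWith f xs ys) ≡⟨ cong₂ _+_ (LP.length-map (f x) ys)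
                                                                      (length-cartesianProductWith f xs ys) ⟩
  length ys + length xs ℕ.* length ys                               ∎
  where open ≡-Reasoning

lookup-injective : ∀ {A : Set} {xs : List A} → Unique xs →
                   ∀ {a b} → lookup xs a ≡ lookup xs b → a ≡ b
lookup-injective {xs = _ ∷ _} (_ ∷ _) {zero} {zero} _ = refl
lookup-injective (x∉xs ∷ _) {zero} {suc b} e = ⊥-elim (All.lookup x∉xs (∈-lookup b) e)
lookup-injective (x∉xs ∷ _) {suc a} {zero} e = ⊥-elim (All.lookup x∉xs (∈-lookup a) (sym e))
lookup-injective (_ ∷ u) {suc a} {suc b} e = cong suc (lookup-injective u e)

-- A duplicate-free list contained in ys is at most as long as ys: sending each
-- position of xs to the position of its entry in ys is injective.
unique⊆⇒length≤ : ∀ {A : Set} {xs ys : List A} → Unique xs →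
                  (∀ {x} → x ∈ xs → x ∈ ys) → length xs ≤ length ys
unique⊆⇒length≤ {xs = xs} {ys} u xs⊆ys = FinP.injective⇒≤ position-injective
  where
  position : Fin (length xs) → Fin (length ys)
  position a = Any.index (xs⊆ys (∈-lookup a))

  entry : ∀ a → lookup xs a ≡ lookup ys (position a)
  entry a = lookup-index (xs⊆ys (∈-lookup a))

  position-injective : ∀ {a b} → position a ≡ position b → a ≡ b
  position-injective {a} {b} e =
    lookup-injective u (trans (entry a) (trans (cong (lookup ys) e) (sym (entry b))))

++-cancel-sameLength : ∀ {A : Set} (p q : List A) {t u : List A} →
                       length p ≡ length q → p ++ t ≡ q ++ u → t ≡ u
++-cancel-sameLength [] [] _ e = e
++-cancel-sameLength (a ∷ p) (b ∷ q) l e =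
  ++-cancel-sameLength p q (ℕP.suc-injective l) (LP.∷-injectiveʳ e)

-- prefixed m L lists the pixels p ++ t with p of layer m and t in L.
prefixed : ℕ → List Pixel → List Pixel
prefixed zero L = L
prefixed (suc m) L = cartesianProductWith _∷_ (allFin 4) (prefixed m L)

prefixed⁺ : ∀ p {t L} → t ∈ L → p ++ t ∈ prefixed (length p) L
prefixed⁺ [] t∈L = t∈L
prefixed⁺ (a ∷ p) t∈L = ∈-cartesianProductWith⁺ _∷_ (∈-allFin a) (prefixed⁺ p t∈L)

prefixed⁻ : ∀ m {L w} → w ∈ prefixed m L → ∃₂ λ p t → length p ≡ m × t ∈ L × w ≡ p ++ t
prefixed⁻ zero w∈ = [] , _ , refl , w∈ , refl
prefixed⁻ (suc m) {L} w∈ with ∈-cartesianProductWith⁻ _∷_ (allFin 4) (prefixed m L) w∈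
... | a , v , _ , v∈ , refl with prefixed⁻ m v∈
...   | p , t , refl , t∈L , refl = a ∷ p , t , refl , t∈L , refl

prefixed-unique : ∀ m {L} → Unique L → Unique (prefixed m L)
prefixed-unique zero u = u
prefixed-unique (suc m) u =
  Unique.cartesianProductWith⁺ _∷_ LP.∷-injective (Unique.allFin⁺ 4) (prefixed-unique m u)

length-prefixed : ∀ m L → length (prefixed m L) ≡ 4 ^ m ℕ.* length L
length-prefixed zero L = sym (ℕP.+-identityʳ (length L))
length-prefixed (suc m) L = begin
  length (prefixed (suc m) L)       ≡⟨ length-cartesianProductWith _∷_ (allFin 4) (prefixed m L) ⟩
  4 ℕ.* length (prefixed m L)       ≡⟨ cong (4 ℕ.*_) (length-prefixed m L) ⟩
  4 ℕ.* (4 ^ m ℕ.* length L)        ≡⟨ ℕP.*-assoc 4 (4 ^ m) (length L) ⟨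
  4 ^ suc m ℕ.* length L            ∎
  where open ≡-Reasoning

pixels : ℕ → List Pixel
pixels m = prefixed m ([] ∷ [])

∈-pixels : ∀ p → p ∈ pixels (length p)
∈-pixels p = subst (_∈ pixels (length p)) (LP.++-identityʳ p) (prefixed⁺ p (here refl))

pixels⇒layer : ∀ m {p} → p ∈ pixels m → layer p ≡ m
pixels⇒layer m p∈ with prefixed⁻ m p∈
... | q , _ , lq , here refl , refl = trans (cong length (LP.++-identityʳ q)) lq

pixels-unique : ∀ m → Unique (pixels m)
pixels-unique m = prefixed-unique m (All.[] ∷ [])

length-pixels : ∀ m → length (pixels m) ≡ 4 ^ m
length-pixels m = trans (length-prefixed m _) (ℕP.*-identityʳ (4 ^ m))

corner : ℕ → Pixel
corner m = replicate m zero

offCorner : ℕ → List Pixel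
offCorner zero = []
offCorner (suc m) =
  L.map (zero ∷_) (offCorner m) ++ cartesianProductWith _∷_ (L.map suc (allFin 3)) (pixels m)

offCorner⁺ : ∀ t → t ≢ corner (length t) → t ∈ offCorner (length t)
offCorner⁺ [] t≢ = ⊥-elim (t≢ refl)
offCorner⁺ (zero ∷ t) t≢ = ∈-++⁺ˡ (∈-map⁺ (zero ∷_) (offCorner⁺ t (λ e → t≢ (cong (zero ∷_) e))))
offCorner⁺ (suc a ∷ t) _ =
  ∈-++⁺ʳ (L.map (zero ∷_) (offCorner (length t))) (∈-cartesianProductWith⁺ _∷_ (∈-map⁺ suc (∈-allFin a)) (∈-pixels t))

offCorner⁻ : ∀ m {t} → t ∈ offCorner m → length t ≡ m × t ≢ corner m
offCorner⁻ (suc m) t∈ with ∈-++⁻ (L.map (zero ∷_) (offCorner m)) t∈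
... | inj₁ t∈ˡ with ∈-map⁻ (zero ∷_) t∈ˡ
...   | v , v∈ , refl with offCorner⁻ m v∈
...     | lv , v≢ = cong suc lv , λ e → v≢ (LP.∷-injectiveʳ e)
offCorner⁻ (suc m) t∈ | inj₂ t∈ʳ with ∈-cartesianProductWith⁻ _∷_ (L.map suc (allFin 3)) (pixels m) t∈ʳ
... | a , v , a∈ , v∈ , refl with ∈-map⁻ suc a∈
...   | _ , _ , refl = cong suc (pixels⇒layer m v∈) , λ ()

offCorner-unique : ∀ m → Unique (offCorner m)
offCorner-unique zero = []
offCorner-unique (suc m) =
  Unique.++⁺ (Unique.map⁺ LP.∷-injectiveʳ (offCorner-unique m))
             (Unique.cartesianProductWith⁺ _∷_ LP.∷-injective
               (Unique.map⁺ FinP.suc-injective (Unique.allFin⁺ 3)) (pixels-unique m))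
             heads-differ
  where
  heads-differ : Disjoint (L.map (zero ∷_) (offCorner m))
                          (cartesianProductWith _∷_ (L.map suc (allFin 3)) (pixels m))
  heads-differ (v∈ˡ , v∈ʳ) with ∈-map⁻ (zero ∷_) v∈ˡ
                              | ∈-cartesianProductWith⁻ _∷_ (L.map suc (allFin 3)) (pixels m) v∈ʳ
  ... | _ , _ , refl | a , _ , a∈ , _ , e with ∈-map⁻ suc a∈
  ...   | _ , _ , refl with e
  ...     | ()

length-offCorner : ∀ m → suc (length (offCorner m)) ≡ 4 ^ m
length-offCorner zero = refl
length-offCorner (suc m) = begin
  suc (length (zeroHalf ++ rest))                ≡⟨ cong suc (LP.length-++ zeroHalf) ⟩
  suc (length zeroHalf + length rest)            ≡⟨ cong₂ (λ a b → suc (a + b))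
                                                      (LP.length-map (zero ∷_) (offCorner m))
                                                      (length-cartesianProductWith _∷_ (L.map suc (allFin 3)) (pixels m)) ⟩
  suc (length (offCorner m)) + 3 ℕ.* length (pixels m) ≡⟨ cong₂ (λ a b → a + 3 ℕ.* b)
                                                      (length-offCorner m) (length-pixels m) ⟩
  4 ^ suc m                                      ∎
  where
  open ≡-Reasoning
  zeroHalf = L.map (zero ∷_) (offCorner m)
  rest = cartesianProductWith _∷_ (L.map suc (allFin 3)) (pixels m)

⊑-++ : ∀ p r → p ⊑ (p ++ r)
⊑-++ [] r = tt
⊑-++ (a ∷ p) r with a ≟F a
... | yes _ = ⊑-++ p r
... | no a≢a = ⊥-elim (a≢a refl)

⊑⇒++ : ∀ p q → p ⊑ q → ∃[ r ] (q ≡ p ++ r)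
⊑⇒++ [] q _ = q , refl
⊑⇒++ (a ∷ p) (b ∷ q) p⊑q with a ≟F b
... | yes refl = let (r , e) = ⊑⇒++ p q p⊑q in r , cong (a ∷_) e

⊑-trans : ∀ p q w → p ⊑ q → q ⊑ w → p ⊑ w
⊑-trans p q w p⊑q q⊑w with ⊑⇒++ p q p⊑q
... | r , refl with ⊑⇒++ (p ++ r) w q⊑w
...   | r′ , refl = subst (p ⊑_) (sym (LP.++-assoc p r r′)) (⊑-++ p (r ++ r′))

⊑-sameLayer : ∀ p q → p ⊑ q → layer q ≤ layer p → p ≡ q
⊑-sameLayer p q p⊑q q≤p with ⊑⇒++ p q p⊑q
... | [] , refl = sym (LP.++-identityʳ p)
... | _ ∷ _ , refl = ⊥-elim (ℕP.m+1+n≰m (length p) (subst (_≤ length p) (LP.length-++ p) q≤p))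

toℚᵘ-/ : ∀ a d .{{_ : NonZero d}} → toℚᵘ (+ a / d) ℚᵘ.≃ (+ a) ℚᵘ./ d
toℚᵘ-/ a (suc d) = ℚP.toℚᵘ-fromℚᵘ (mkℚᵘ (+ a) d)

frac-≤ : ∀ a b c d .{{_ : NonZero b}} .{{_ : NonZero d}} →
         a ℕ.* d ≤ c ℕ.* b → + a / b ≤ℚ + c / d
frac-≤ a b@(suc _) c d@(suc _) ad≤cb =
  ℚP.toℚᵘ-cancel-≤ (ℚᵘP.≤-respʳ-≃ (ℚᵘP.≃-sym (toℚᵘ-/ c d)) (ℚᵘP.≤-respˡ-≃ (ℚᵘP.≃-sym (toℚᵘ-/ a b))
    (*≤* (subst₂ ℤ._≤_ (pos-* a d) (pos-* c b) (ℤ.+≤+ ad≤cb)))))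

frac-+ : ∀ a b d .{{_ : NonZero d}} → + a / d +ℚ + b / d ≡ + (a + b) / d
frac-+ a b d@(suc _) = ℚP.toℚᵘ-injective (begin
  toℚᵘ (+ a / d +ℚ + b / d)           ≈⟨ ℚP.toℚᵘ-homo-+ (+ a / d) (+ b / d) ⟩
  toℚᵘ (+ a / d) ℚᵘ.+ toℚᵘ (+ b / d)  ≈⟨ ℚᵘP.+-cong (toℚᵘ-/ a d) (toℚᵘ-/ b d) ⟩
  (+ a ℚᵘ./ d) ℚᵘ.+ (+ b ℚᵘ./ d)      ≈⟨ *≡* cross-multiplied ⟩
  + (a + b) ℚᵘ./ d                    ≈⟨ toℚᵘ-/ (a + b) d ⟨
  toℚᵘ (+ (a + b) / d)                ∎)
  where
  open ℚᵘP.≃-Reasoning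
  ring : ∀ (x y z : ℤ.ℤ) → (x ℤ.* z ℤ.+ y ℤ.* z) ℤ.* z ≡ (x ℤ.+ y) ℤ.* (z ℤ.* z)
  ring = solve-∀
  cross-multiplied : (+ a ℤ.* + d ℤ.+ + b ℤ.* + d) ℤ.* + d ≡ (+ a ℤ.+ + b) ℤ.* + (d ℕ.* d)
  cross-multiplied = trans (ring (+ a) (+ b) (+ d)) (cong ((+ a ℤ.+ + b) ℤ.*_) (sym (pos-* d d)))

frac-* : ∀ a b c d .{{_ : NonZero b}} .{{_ : NonZero d}} →
         (+ a / b) * (+ c / d) ≡ (+ (a ℕ.* c) / (b ℕ.* d)) {{ℕP.m*n≢0 b d}}
frac-* a b@(suc _) c d@(suc _) = ℚP.toℚᵘ-injective (begin
  toℚᵘ ((+ a / b) * (+ c / d))          ≈⟨ ℚP.toℚᵘ-homo-* (+ a / b) (+ c / d) ⟩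
  toℚᵘ (+ a / b) ℚᵘ.* toℚᵘ (+ c / d)    ≈⟨ ℚᵘP.*-cong (toℚᵘ-/ a b) (toℚᵘ-/ c d) ⟩
  (+ a ℚᵘ./ b) ℚᵘ.* (+ c ℚᵘ./ d)        ≡⟨ cong (ℚᵘ._/ (b ℕ.* d)) (sym (pos-* a c)) ⟩
  + (a ℕ.* c) ℚᵘ./ (b ℕ.* d)            ≈⟨ toℚᵘ-/ (a ℕ.* c) (b ℕ.* d) ⟨
  toℚᵘ (+ (a ℕ.* c) / (b ℕ.* d))        ∎)
  where open ℚᵘP.≃-Reasoning

inv4^-nonneg : ∀ j → 0ℚ ≤ℚ inv4^ j
inv4^-nonneg j = ℚP.nonNegative⁻¹ (inv4^ j) {{ℚP.normalize-nonNeg 1 (4 ^ j) {{ℕP.m^n≢0 4 j}}}}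

inv4^-antitone : ∀ {j k} → j ≤ k → inv4^ k ≤ℚ inv4^ j
inv4^-antitone {j} {k} j≤k = frac-≤ 1 (4 ^ k) 1 (4 ^ j) {{ℕP.m^n≢0 4 k}} {{ℕP.m^n≢0 4 j}}
  (ℕP.*-monoʳ-≤ 1 (ℕP.^-monoʳ-≤ 4 j≤k))

inv4^-quarters : ∀ j → let x = inv4^ (suc j) in inv4^ j ≤ℚ x +ℚ (x +ℚ (x +ℚ (x +ℚ 0ℚ)))
inv4^-quarters j = subst (inv4^ j ≤ℚ_) (sym four-quarters)
  (frac-≤ 1 (4 ^ j) 4 (4 ^ suc j) (ℕP.≤-reflexive (ℕP.+-identityʳ (4 ^ suc j))))
  where
  instance
    4^j≢0 : NonZero (4 ^ j)
    4^j≢0 = ℕP.m^n≢0 4 j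
    4^1+j≢0 : NonZero (4 ^ suc j)
    4^1+j≢0 = ℕP.m^n≢0 4 (suc j)
  x = inv4^ (suc j)
  four-quarters : x +ℚ (x +ℚ (x +ℚ (x +ℚ 0ℚ))) ≡ + 4 / 4 ^ suc j
  four-quarters = begin
    x +ℚ (x +ℚ (x +ℚ (x +ℚ 0ℚ)))  ≡⟨ cong (λ y → x +ℚ (x +ℚ (x +ℚ y))) (ℚP.+-identityʳ x) ⟩
    x +ℚ (x +ℚ (x +ℚ x))          ≡⟨ cong (λ y → x +ℚ (x +ℚ y)) (frac-+ 1 1 (4 ^ suc j)) ⟩
    x +ℚ (x +ℚ (+ 2 / 4 ^ suc j)) ≡⟨ cong (x +ℚ_) (frac-+ 1 2 (4 ^ suc j)) ⟩
    x +ℚ (+ 3 / 4 ^ suc j)        ≡⟨ frac-+ 1 3 (4 ^ suc j) ⟩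
    + 4 / 4 ^ suc j               ∎
    where open ≡-Reasoning

sumℚ-mono : ∀ {A : Set} (g h : A → ℚ) (xs : List A) → (∀ {x} → x ∈ xs → g x ≤ℚ h x) →
            sumℚ (L.map g xs) ≤ℚ sumℚ (L.map h xs)
sumℚ-mono g h [] _ = ℚP.≤-refl
sumℚ-mono g h (x ∷ xs) g≤h = ℚP.+-mono-≤ (g≤h (here refl)) (sumℚ-mono g h xs (λ x∈ → g≤h (there x∈)))

sumℚ-nonneg : ∀ {A : Set} (g : A → ℚ) (xs : List A) → (∀ x → 0ℚ ≤ℚ g x) → 0ℚ ≤ℚ sumℚ (L.map g xs)
sumℚ-nonneg g [] _ = ℚP.≤-refl
sumℚ-nonneg g (x ∷ xs) g≥0 = ℚP.+-mono-≤ (g≥0 x) (sumℚ-nonneg g xs g≥0)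

sumℚ-≥-term : ∀ {A : Set} (g : A → ℚ) {x : A} (xs : List A) → (∀ y → 0ℚ ≤ℚ g y) →
              x ∈ xs → g x ≤ℚ sumℚ (L.map g xs)
sumℚ-≥-term g (y ∷ ys) g≥0 (here refl) =
  subst (_≤ℚ g y +ℚ sumℚ (L.map g ys)) (ℚP.+-identityʳ (g y)) (ℚP.+-monoʳ-≤ (g y) (sumℚ-nonneg g ys g≥0))
sumℚ-≥-term g {x} (y ∷ ys) g≥0 (there x∈) =
  subst (_≤ℚ g y +ℚ sumℚ (L.map g ys)) (ℚP.+-identityˡ (g x)) (ℚP.+-mono-≤ (g≥0 y) (sumℚ-≥-term g ys g≥0 x∈))

anyᵇ-false : ∀ {n} (P : Placement n) (f : Pixel → Bool) → (∀ k → ¬ T (f (P k))) → anyᵇ P f ≡ false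
anyᵇ-false {n} P f none with anyᵇ P f in eq
... | false = refl
... | true with Any.satisfied (any⁻ (λ k → f (P k)) (allFin n) (subst T (sym eq) tt))
...   | k , holds = ⊥-elim (none k holds)

layer-∷ʳ : ∀ p (a : Quad) → layer (p ∷ʳ a) ≡ suc (layer p)
layer-∷ʳ p a = trans (LP.length-++ p) (ℕP.+-comm (length p) 1)

module Capacity {n : ℕ} (P : Placement n) where

  capAt-leaf : ∀ f p → occOrBlockedᵇ P p ≡ false → containsᵇ P p ≡ false → capAt f P p ≡ inv4^ (layer p)
  capAt-leaf f p free none rewrite free | none = refl

  capAt-node : ∀ f p → occOrBlockedᵇ P p ≡ false → containsᵇ P p ≡ true →
               capAt (suc f) P p ≡ sumℚ (L.map (capAt f P) (children p))
  capAt-node f p free some rewrite free | some = refl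

  capAt-nonneg : ∀ f p → 0ℚ ≤ℚ capAt f P p
  capAt-nonneg zero p with occOrBlockedᵇ P p | containsᵇ P p
  ... | true  | _     = ℚP.≤-refl
  ... | false | false = inv4^-nonneg (layer p)
  ... | false | true  = ℚP.≤-refl
  capAt-nonneg (suc f) p with occOrBlockedᵇ P p | containsᵇ P p
  ... | true  | _     = ℚP.≤-refl
  ... | false | false = inv4^-nonneg (layer p)
  ... | false | true  = sumℚ-nonneg (capAt f P) (children p) (capAt-nonneg f)

  empty-contains-nothing : ∀ e → Empty P e → containsᵇ P e ≡ false
  empty-contains-nothing e emp = anyᵇ-false P (e ⊑ᵇ_) (λ k e⊑Pk → proj₂ (emp k) e⊑Pk)

  above-empty-free : ∀ p r → Empty P (p ++ r) → occOrBlockedᵇ P p ≡ false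
  above-empty-free p r emp = anyᵇ-false P (_⊑ᵇ p)
    (λ k Pk⊑p → proj₁ (emp k) (⊑-trans (P k) p (p ++ r) Pk⊑p (⊑-++ p r)))

  -- Case analysis on whether p contains a square, keeping the goal A intact
  -- (a direct 'with' would also rewrite inside the unfolded capAt).
  by-contents : ∀ p {A : Set} → (containsᵇ P p ≡ false → A) → (containsᵇ P p ≡ true → A) → A
  by-contents p none some with containsᵇ P p
  ... | false = none refl
  ... | true  = some refl

  leaf-cap-≥ : ∀ f p d → occOrBlockedᵇ P p ≡ false → containsᵇ P p ≡ false →
               inv4^ (layer p + d) ≤ℚ capAt f P p
  leaf-cap-≥ f p d free none =
    ℚP.≤-trans (inv4^-antitone (ℕP.m≤m+n (layer p) d)) (ℚP.≤-reflexive (sym (capAt-leaf f p free none)))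

  cap-above-empty : ∀ f p r → length r ≤ f → Empty P (p ++ r) →
                    inv4^ (layer p + length r) ≤ℚ capAt f P p
  cap-above-empty f p [] _ emp = ℚP.≤-reflexive (begin
    inv4^ (layer p + 0)  ≡⟨ cong inv4^ (ℕP.+-identityʳ (layer p)) ⟩
    inv4^ (layer p)      ≡⟨ capAt-leaf f p (above-empty-free p [] emp) (empty-contains-nothing p p-empty) ⟨
    capAt f P p          ∎)
    where
    open ≡-Reasoning
    p-empty : Empty P p
    p-empty = subst (Empty P) (LP.++-identityʳ p) emp
  cap-above-empty (suc f) p (a ∷ r) (s≤s |r|≤f) emp =
    by-contents p (leaf-cap-≥ (suc f) p (length (a ∷ r)) (above-empty-free p (a ∷ r) emp)) λ con → begin
    inv4^ (layer p + suc (length r))     ≡⟨ cong inv4^ (trans (ℕP.+-suc (layer p) (length r))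
                                                         (cong (_+ length r) (sym (layer-∷ʳ p a)))) ⟩
    inv4^ (layer (p ∷ʳ a) + length r)    ≤⟨ cap-above-empty f (p ∷ʳ a) r |r|≤f child-empty ⟩
    capAt f P (p ∷ʳ a)                   ≤⟨ sumℚ-≥-term (capAt f P) (children p) (capAt-nonneg f)
                                                (∈-map⁺ (p ∷ʳ_) (∈-allFin a)) ⟩
    sumℚ (L.map (capAt f P) (children p)) ≡⟨ capAt-node f p (above-empty-free p (a ∷ r) emp) con ⟨
    capAt (suc f) P p                    ∎
    where
    open ℚP.≤-Reasoning
    child-empty : Empty P ((p ∷ʳ a) ++ r)
    child-empty = subst (Empty P) (sym (LP.∷ʳ-++ p a r)) emp

  -- If the d-corner of every h-descendant of p is empty, these 4^h corners
  -- give cap(p) ≥ 4^h · 4^-(layer p + h + d) = 4^-(layer p + d).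
  cap-spread : ∀ h d f p → h + d ≤ f → (∀ q → length q ≡ h → Empty P (p ++ q ++ corner d)) →
               inv4^ (layer p + d) ≤ℚ capAt f P p
  cap-spread zero d f p d≤f corners =
    subst (λ x → inv4^ (layer p + x) ≤ℚ capAt f P p) (LP.length-replicate d)
      (cap-above-empty f p (corner d) (subst (_≤ f) (sym (LP.length-replicate d)) d≤f) (corners [] refl))
  cap-spread (suc h) d (suc f) p (s≤s h+d≤f) corners =
    by-contents p (leaf-cap-≥ (suc f) p d free) λ con → begin
    inv4^ (layer p + d)                                   ≤⟨ inv4^-quarters (layer p + d) ⟩
    sumℚ (L.map (λ _ → inv4^ (suc (layer p + d))) (children p)) ≤⟨ sumℚ-mono _ (capAt f P) (children p) child ⟩
    sumℚ (L.map (capAt f P) (children p))                 ≡⟨ capAt-node f p free con ⟨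
    capAt (suc f) P p                                     ∎
    where
    open ℚP.≤-Reasoning
    free : occOrBlockedᵇ P p ≡ false
    free = above-empty-free p _ (corners (corner (suc h)) (LP.length-replicate (suc h)))
    child : ∀ {x} → x ∈ children p → inv4^ (suc (layer p + d)) ≤ℚ capAt f P x
    child x∈ with ∈-map⁻ (p ∷ʳ_) x∈
    ... | a , _ , refl = subst (λ l → inv4^ (l + d) ≤ℚ capAt f P (p ∷ʳ a)) (layer-∷ʳ p a)
                           (cap-spread h d f (p ∷ʳ a) h+d≤f child-corners)
      where
      child-corners : ∀ q → length q ≡ h → Empty P ((p ∷ʳ a) ++ q ++ corner d)
      child-corners q |q| = subst (Empty P) (sym (LP.∷ʳ-++ p a (q ++ corner d))) (corners (a ∷ q) (cong suc |q|))

unmoved : ∀ {n} {P P′ : Placement n} {ks} → Moves P P′ ks → ∀ k → k ∈ ks ⊎ P′ k ≡ P k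
unmoved done k = inj₂ refl
unmoved (step {k = k₀} move rest) k with k ≟F k₀
... | yes k≡k₀ = inj₁ (here k≡k₀)
... | no k≢k₀ with unmoved rest k
...   | inj₁ k∈ = inj₁ (there k∈)
...   | inj₂ e = inj₂ (trans e (proj₂ (proj₂ move) k k≢k₀))

moved-below : ∀ {n} {P P′ : Placement n} {ks} {q} → Moves P P′ ks → Empty P′ q →
              ∀ k → q ⊑ P k → k ∈ ks
moved-below {q = q} moves emp k q⊑Pk with unmoved moves k
... | inj₁ k∈ = k∈
... | inj₂ e = ⊥-elim (proj₂ (emp k) (subst (q ⊑_) (sym e) q⊑Pk))

cost-≥ : ∀ {n} {P P′ : Placement n} {ks} {q} (W : List Pixel) → Moves P P′ ks → Empty P′ q →
         Unique W → (∀ {w} → w ∈ W → q ⊑ w × ∃[ k ] P k ≡ w) → length W ≤ cost ks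
cost-≥ {P = P} {ks = ks} W moves emp unique occupied-below =
  ℕP.≤-trans (unique⊆⇒length≤ unique W⊆moved) (ℕP.≤-reflexive (LP.length-map P (deduplicate _≟F_ ks)))
  where
  W⊆moved : ∀ {w} → w ∈ W → w ∈ L.map P (deduplicate _≟F_ ks)
  W⊆moved w∈ with occupied-below w∈
  ... | q⊑w , k , refl = ∈-map⁺ P (∈-deduplicate⁺ _≟F_ (moved-below moves emp k q⊑w))

foldr-⊔-≥ : ∀ {A : Set} (g : A → ℕ) {x} (xs : List A) → x ∈ xs → g x ≤ foldr _⊔_ 0 (L.map g xs)
foldr-⊔-≥ g (y ∷ ys) (here refl) = ℕP.m≤m⊔n (g y) _
foldr-⊔-≥ g (y ∷ ys) (there x∈) = ℕP.≤-trans (foldr-⊔-≥ g ys x∈) (ℕP.m≤n⊔m (g y) _)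

foldr-⊔-≤ : ∀ {A : Set} (g : A → ℕ) (xs : List A) {b} → (∀ x → g x ≤ b) → foldr _⊔_ 0 (L.map g xs) ≤ b
foldr-⊔-≤ g [] _ = z≤n
foldr-⊔-≤ g (x ∷ xs) g≤b = ℕP.⊔-lub (g≤b x) (foldr-⊔-≤ g xs g≤b)

layer-≤-maxLayer : ∀ {n} (P : Placement n) k → layer (P k) ≤ maxLayer P
layer-≤-maxLayer {n} P k = foldr-⊔-≥ (λ k → layer (P k)) (allFin n) (∈-allFin k)

maxLayer-≤ : ∀ {n} (P : Placement n) {b} → (∀ k → layer (P k) ≤ b) → maxLayer P ≤ b
maxLayer-≤ {n} P = foldr-⊔-≤ (λ k → layer (P k)) (allFin n)

height-≤ : ∀ C → height C ≤ suc (maxLayer (pos C))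
height-≤ record { n = zero } = z≤n
height-≤ record { n = suc _ } = ℕP.≤-refl

-- Distinct pixels of one layer are incomparable, so the entries of a
-- duplicate-free list of pixels of one layer form a valid placement.
sameLayer-valid : ∀ {W : List Pixel} {m} → Unique W → (∀ {w} → w ∈ W → layer w ≡ m) → Valid (lookup W)
sameLayer-valid {W} u same a b a≢b Wa⊑Wb = a≢b (lookup-injective u
  (⊑-sameLayer (lookup W a) (lookup W b) Wa⊑Wb
    (ℕP.≤-reflexive (trans (same (∈-lookup b)) (sym (same (∈-lookup a)))))))

-- The configuration T_i: inside each i-pixel q, a 2i-square on every
-- 2i-pixel q ++ t below q except the corner q ++ corner i.
module Construction (i : ℕ) where

  squares : List Pixel
  squares = prefixed i (offCorner i)

  squares⁺ : ∀ q {t} → length q ≡ i → t ∈ offCorner i → q ++ t ∈ squares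
  squares⁺ q {t} |q| t∈ = subst (λ m → q ++ t ∈ prefixed m (offCorner i)) |q| (prefixed⁺ q t∈)

  squares⁻ : ∀ {w} → w ∈ squares →
             ∃₂ λ p t → length p ≡ i × length t ≡ i × t ≢ corner i × w ≡ p ++ t
  squares⁻ w∈ with prefixed⁻ i w∈
  ... | p , t , |p| , t∈ , w≡ = p , t , |p| , proj₁ (offCorner⁻ i t∈) , proj₂ (offCorner⁻ i t∈) , w≡

  layer-squares : ∀ {w} → w ∈ squares → layer w ≡ i + i
  layer-squares w∈ with squares⁻ w∈
  ... | p , t , |p| , |t| , _ , refl = trans (LP.length-++ p) (cong₂ _+_ |p| |t|)

  P : Placement (length squares)
  P = lookup squares

  layer-P : ∀ k → layer (P k) ≡ i + i
  layer-P k = layer-squares (∈-lookup k)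

  config : Config
  config = record { n = length squares
             ; pos = P
             ; valid = sameLayer-valid (prefixed-unique i (offCorner-unique i)) layer-squares }

  -- The corner of each i-pixel is empty: a square comparable with it lies on
  -- the same layer 2i, hence would equal it, but squares avoid corners.
  corner-empty : ∀ q → length q ≡ i → Empty P (q ++ corner i)
  corner-empty q |q| k =
    (λ Pk⊑c → not-corner (⊑-sameLayer (P k) c Pk⊑c (ℕP.≤-reflexive (trans |c| (sym (layer-P k))))))
    , (λ c⊑Pk → not-corner (sym (⊑-sameLayer c (P k) c⊑Pk (ℕP.≤-reflexive (trans (layer-P k) (sym |c|))))))
    where
    c = q ++ corner i
    |c| : layer c ≡ i + i
    |c| = trans (LP.length-++ q) (cong₂ _+_ |q| (LP.length-replicate i))
    not-corner : P k ≢ c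
    not-corner Pk≡c with squares⁻ (∈-lookup k)
    ... | p , t , |p| , _ , t≢corner , Pk≡pt =
      t≢corner (++-cancel-sameLength p q (trans |p| (sym |q|)) (trans (sym Pk≡pt) Pk≡c))

  -- The 4^i corners, of area 4^-2i each, give capacity 4^-i once the fuel reaches layer 2i.
  capacity : i + i ≤ suc (maxLayer P) → inv4^ i ≤ℚ cap config
  capacity fuel = Capacity.cap-spread P i i (suc (maxLayer P)) [] fuel corner-empty

  -- Emptying an i-pixel q moves the 4^i - 1 squares q ++ t below it.
  insertion-cost : InsertionCostAtLeast config i (4 ^ i ∸ 1)
  insertion-cost P′ ks moves (q , |q| , emp) =
    subst (_≤ cost ks) |below-q| (cost-≥ below-q moves emp unique occupied)
    where
    below-q : List Pixel
    below-q = L.map (q ++_) (offCorner i)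
    |below-q| : length below-q ≡ 4 ^ i ∸ 1
    |below-q| = trans (LP.length-map (q ++_) (offCorner i)) (cong ℕ.pred (length-offCorner i))
    unique : Unique below-q
    unique = Unique.map⁺ (LP.++-cancelˡ q _ _) (offCorner-unique i)
    occupied : ∀ {w} → w ∈ below-q → q ⊑ w × ∃[ k ] P k ≡ w
    occupied w∈ with ∈-map⁻ (q ++_) w∈
    ... | t , t∈ , refl = ⊑-++ q t , Any.index q++t∈ , sym (lookup-index q++t∈)
      where
      q++t∈ : q ++ t ∈ squares
      q++t∈ = squares⁺ q |q| t∈

  height-config : height config ≤ suc (i + i)
  height-config = ℕP.≤-trans (height-≤ config) (s≤s (maxLayer-≤ P (λ k → ℕP.≤-reflexive (layer-P k))))

open Construction using (config; P; layer-P)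

-- For i ≥ 1, T_i has a square, e.g. on corner i ++ (1 ∷ corner (i - 1)).
a-square : ∀ j → Fin (length (Construction.squares (suc j)))
a-square j = Any.index (Construction.squares⁺ (suc j) (corner (suc j)) (LP.length-replicate (suc j)) tail∈)
  where
  tail∈ : suc zero ∷ corner j ∈ offCorner (suc j)
  tail∈ = subst (λ m → suc zero ∷ corner j ∈ offCorner m) (cong suc (LP.length-replicate j))
                (offCorner⁺ (suc zero ∷ corner j) (λ ()))

-- So the capacity recursion of T_i reaches layer 2i, and all squares are 2i-squares.
fuel : ∀ i → i + i ≤ suc (maxLayer (P i))
fuel zero = z≤n
fuel (suc j) = ℕP.m≤n⇒m≤1+n
  (subst (_≤ maxLayer (P (suc j))) (layer-P (suc j) (a-square j)) (layer-≤-maxLayer (P (suc j)) (a-square j)))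

smallest : ∀ i → SmallestIs (config i) (i + i)
smallest zero = (λ k → ℕP.≤-reflexive (layer-P zero k)) , inj₁ refl
smallest (suc j) = (λ k → ℕP.≤-reflexive (layer-P (suc j) k)) , inj₂ (a-square j , layer-P (suc j) (a-square j))

bound-diagonal : ∀ i → bound i (i + i) ≡ 4 ^ i ∸ 1
bound-diagonal i = cong (λ e → 4 ^ e ∸ 1) (trans (cong (ℕ._⊓ i) (ℕP.m+n∸n≡m i i)) (ℕP.⊓-idem i))

good : ∀ i → Good i (config i) (i + i)
good i = Construction.capacity i (fuel i)
       , smallest i
       , subst (InsertionCostAtLeast (config i) i) (sym (bound-diagonal i)) (Construction.insertion-cost i)

-- Arithmetic for the constant c = 1/8: 2^(2i+1) = 2·4^i ≤ 8·(4^i - 1) for i ≥ 1.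
2^[m+m]≡4^m : ∀ m → 2 ^ (m + m) ≡ 4 ^ m
2^[m+m]≡4^m zero = refl
2^[m+m]≡4^m (suc m) = begin
  2 ℕ.* 2 ^ (m + suc m)      ≡⟨ cong (λ e → 2 ℕ.* 2 ^ e) (ℕP.+-suc m m) ⟩
  2 ℕ.* (2 ℕ.* 2 ^ (m + m))  ≡⟨ ℕP.*-assoc 2 2 (2 ^ (m + m)) ⟨
  4 ℕ.* 2 ^ (m + m)          ≡⟨ cong (4 ℕ.*_) (2^[m+m]≡4^m m) ⟩
  4 ℕ.* 4 ^ m                ∎
  where open ≡-Reasoning

2^[2i+1]≤8[4^i∸1] : ∀ j → 2 ^ suc (suc j + suc j) ≤ (4 ^ suc j ∸ 1) ℕ.* 8
2^[2i+1]≤8[4^i∸1] j with 4 ^ j | 2^[m+m]≡4^m (suc j) | ℕP.m^n>0 4 j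
... | suc y | 2^2i≡4^i | _ = begin
  2 ℕ.* 2 ^ (suc j + suc j)   ≡⟨ cong (2 ℕ.*_) 2^2i≡4^i ⟩
  2 ℕ.* (4 ℕ.* suc y)         ≡⟨ ℕP.*-assoc 2 4 (suc y) ⟨
  8 ℕ.* suc y                 ≡⟨ ℕP.*-comm 8 (suc y) ⟩
  suc y ℕ.* 8                 ≤⟨ ℕP.*-monoˡ-≤ 8 (ℕP.≤-trans (ℕP.m≤n+m (suc y) y)
                                   (ℕP.+-monoʳ-≤ y (ℕP.m≤m+n (suc y) (2 ℕ.* suc y)))) ⟩
  (4 ℕ.* suc y ∸ 1) ℕ.* 8     ∎
  where open ℕP.≤-Reasoning

eighth-≤ : ∀ x y → x ≤ y ℕ.* 8 → (+ 1 / 8) * (+ x / 1) ≤ℚ + y / 1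
eighth-≤ x y x≤8y = subst (_≤ℚ + y / 1) (sym (frac-* 1 8 x 1))
  (frac-≤ (1 ℕ.* x) 8 y 1 (subst (_≤ y ℕ.* 8) (sym (ℕP.*-identityʳ (1 ℕ.* x)))
                                         (subst (_≤ y ℕ.* 8) (sym (ℕP.*-identityˡ x)) x≤8y)))

height-vs-bound : ∀ j → (+ 1 / 8) * (+ (2 ^ height (config (suc j))) / 1) ≤ℚ (+ bound (suc j) (suc j + suc j) / 1)
height-vs-bound j = eighth-≤ (2 ^ height (config (suc j))) (bound (suc j) (suc j + suc j)) (ℕP.≤-trans (ℕP.^-monoʳ-≤ 2 (Construction.height-config (suc j)))
  (subst (λ b → 2 ^ suc (suc j + suc j) ≤ b ℕ.* 8) (sym (bound-diagonal (suc j))) (2^[2i+1]≤8[4^i∸1] j)))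

theorem5 : ((i : ℕ) → ∃[ T ] ∃[ s ] Good i T s)
           × ∃[ c ] (0ℚ < c × ((i : ℕ) → 1 ≤ i → ∃[ T ] ∃[ s ]
               (Good i T s × c * (+ (2 ^ height T) / 1) ≤ℚ (+ bound i s / 1))))
theorem5 = (λ i → config i , i + i , good i)
         , + 1 / 8 , ℚP.positive⁻¹ (+ 1 / 8)
         , λ { (suc j) _ → config (suc j) , suc j + suc j , good (suc j) , height-vs-bound j }
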